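{- Let $K$, $P$, $wAI(P)$ and the equivalence $\equiv$ be as in the context. For all $\overline{z_1},\overline{z_2},\overline{z_3}\in wAI(P)/\equiv$: (i) $(\overline{z_1}\oplus\overline{z_2})\oplus\overline{z_3}=\overline{z_1}\oplus(\overline{z_2}\oplus\overline{z_3})$; (ii) $\overline{z_1}\oplus\overline{z_2}=\overline{z_2}\oplus\overline{z_1}$; (iii) $\overline{z_1}\oplus\overline{z_1}=\overline{z_1}$; (iv) $\overline{z_1}\oplus\overline{0}=\overline{z_1}$; (v) $(\overline{z_1}\otimes\overline{z_2})\otimes\overline{z_3}=\overline{z_1}\otimes(\overline{z_2}\otimes\overline{z_3})$; (vi) $\overline{z_1}\otimes\overline{z_2}=\overline{z_2}\otimes\overline{z_1}$; (vii) $\overline{z_1}\otimes\overline{1}=\overline{z_1}$; (viii) $\overline{z_1}\otimes\overline{0}=\overline{0}$; (ix) $\overline{z_1}\otimes(\overline{z_2}\oplus\overline{z_3})=(\overline{z_1}\otimes\overline{z_2})\oplus(\overline{z_1}\otimes\overline{z_3})$; (x) $(\overline{z_1}\oplus\overline{z_2})\otimes\overline{z_3}=(\overline{z_1}\otimes\overline{z_3})\oplus(\overline{z_2}\otimes\overline{z_3})$.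
   Context: $(K,\oplus,\otimes,\hat0,\hat1)$ is a commutative and additively idempotent semiring. $P$ is a finite nonempty set of ports with $0,1\notin P$, each $p\in P$ having a fixed weight $k_p\in K$. $\Gamma(P)=2^{2^P}$. The terms of the weighted Algebra of Interactions $wAI(P)$ are generated by $z::=0\mid 1\mid p\mid z\oplus z\mid z\otimes z\mid (z)$, $p\in P$. Semantics: for $\gamma\in\Gamma(P)$, $\|0\|(\gamma)=\hat0$; $\|1\|(\gamma)=\hat1$ if $\emptyset\in\gamma$, else $\hat0$; $\|p\|(\gamma)=k_p$ if some $a\in\gamma$ contains $p$, else $\hat0$; $\|z_1\oplus z_2\|(\gamma)=\bigoplus_{a\in\gamma}(\|z_1\|(\{a\})\oplus\|z_2\|(\{a\}))$; $\|z_1\otimes z_2\|(\gamma)=\bigoplus_{a\in\gamma}\bigoplus_{a=a_1\cup a_2}(\|z_1\|(\{a_1\})\otimes\|z_2\|(\{a_2\}))$, the inner sum over all pairs of (possibly empty) subsets $a_1,a_2\subseteq P$ with $a_1\cup a_2=a$; $\|(z)\|(\gamma)=\|z\|(\gamma)$; empty sums are $\hat0$. Two terms are equivalent, $z_1\equiv z_2$, iff $\|z_1\|(\gamma)=\|z_2\|(\gamma)$ for all $\gamma\in\Gamma(P)$. $\overline{z}$ denotes the $\equiv$-class of $z$, and on $wAI(P)/\equiv$ one sets $\overline{z_1}\oplus\overline{z_2}=\overline{z_1\oplus z_2}$ and $\overline{z_1}\otimes\overline{z_2}=\overline{z_1\otimes z_2}$ (these are well defined). -}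

module Defs where

open import Level using (Level)
open import Algebra.Bundles using (CommutativeSemiring)
open import Data.Bool using (Bool; true; false; if_then_else_; _∧_; _∨_)
open import Data.Bool.Properties renaming (_≟_ to _≟ᴮ_)
open import Data.Nat using (ℕ; zero; suc)
open import Data.Fin using (Fin)
open import Data.Fin.Subset using (Subset; _∪_)
open import Data.Vec using (Vec; []; _∷_; lookup)
open import Data.Vec.Properties using (≡-dec)
open import Data.List using (List; []; _∷_; map; concatMap; foldr)
open import Relation.Nullary.Decidable using (does)

allSubsets : (n : ℕ) → List (Subset n)
allSubsets zero = [] ∷ []
allSubsets (suc n) = map (true ∷_) (allSubsets n) Data.List.++ map (false ∷_) (allSubsets n)

_==ˢ_ : {n : ℕ} → Subset n → Subset n → Bool
a ==ˢ b = does (≡-dec _≟ᴮ_ a b)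

-- Γ(P) = 2^(2^P): a set of subsets of P, given by its (decidable) characteristic function.
Γ : ℕ → Set
Γ n = Subset n → Bool

⟦_⟧ˢ : {n : ℕ} → Subset n → Γ n
⟦ a ⟧ˢ b = b ==ˢ a

data wAI (n : ℕ) : Set where
  𝟘 𝟙 : wAI n
  port : Fin n → wAI n
  _⊕_ _⊗_ : wAI n → wAI n → wAI n
  ⟨_⟩ : wAI n → wAI n

infixl 6 _⊕_
infixl 7 _⊗_

module Semantics {c ℓ : Level} (K : CommutativeSemiring c ℓ) {n : ℕ}
                 (k : Fin n → CommutativeSemiring.Carrier K) where
  open CommutativeSemiring K renaming (_+_ to _⊕ᴷ_; _*_ to _⊗ᴷ_; 0# to 0̂; 1# to 1̂)

  ⨁ : {A : Set} → List A → (A → Carrier) → Carrier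
  ⨁ xs f = foldr (λ x r → f x ⊕ᴷ r) 0̂ xs

  ⨁∈ : Γ n → (Subset n → Carrier) → Carrier
  ⨁∈ γ f = ⨁ (allSubsets n) (λ a → if γ a then f a else 0̂)

  anyIn : Γ n → (Subset n → Bool) → Bool
  anyIn γ p = foldr (λ a r → (γ a ∧ p a) ∨ r) false (allSubsets n)

  ‖_‖ : wAI n → Γ n → Carrier
  ‖ 𝟘 ‖ γ = 0̂
  ‖ 𝟙 ‖ γ = if γ (Data.Vec.replicate n false) then 1̂ else 0̂
  ‖ port p ‖ γ = if anyIn γ (λ a → lookup a p) then k p else 0̂
  ‖ z₁ ⊕ z₂ ‖ γ = ⨁∈ γ (λ a → ‖ z₁ ‖ ⟦ a ⟧ˢ ⊕ᴷ ‖ z₂ ‖ ⟦ a ⟧ˢ)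
  ‖ z₁ ⊗ z₂ ‖ γ = ⨁∈ γ (λ a →
      ⨁ (allSubsets n) (λ a₁ → ⨁ (allSubsets n) (λ a₂ →
        if (a₁ ∪ a₂) ==ˢ a then ‖ z₁ ‖ ⟦ a₁ ⟧ˢ ⊗ᴷ ‖ z₂ ‖ ⟦ a₂ ⟧ˢ else 0̂)))
  ‖ ⟨ z ⟩ ‖ γ = ‖ z ‖ γ

  infix 4 _≡ʷ_
  _≡ʷ_ : wAI n → wAI n → Set ℓ
  z₁ ≡ʷ z₂ = (γ : Γ n) → ‖ z₁ ‖ γ ≈ ‖ z₂ ‖ γ

AddIdempotent : {c ℓ : Level} → CommutativeSemiring c ℓ → Set (c Level.⊔ ℓ)
AddIdempotent K = ∀ x → (x + x) ≈ x
  where open CommutativeSemiring K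

{-# OPTIONS --safe #-}
module Submission where

-- Every term is additive over interactions: ‖ z ‖ γ is the sum over a ∈ γ of its
-- weight ‖ z ‖ {a} (for a port this needs the idempotence of ⊕ in K).  Equivalence of
-- terms is therefore equality of weight functions 2^P → K, and on weights ⊕ acts as
-- pointwise addition while ⊗ acts as the union convolution
-- (f ⋆ g)(a) = ⨁_{a₁ ∪ a₂ = a} f(a₁) ⊗ g(a₂), whose unit is the indicator of ∅.
-- The ten laws are the commutative-semiring laws of these two operations, together
-- with the idempotence of addition inherited from K.

open import Defs
open import Level using (Level)
open import Algebra.Bundles using (CommutativeSemiring)
open import Data.Nat using (ℕ; suc; zero)
open import Data.Fin using (Fin)
open import Data.Fin.Subset using (Subset; _∪_; ⊥)
open import Data.Fin.Subset.Properties using (∪-assoc; ∪-comm; ∪-identityʳ)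
open import Data.Bool using (Bool; true; false; if_then_else_; _∧_; _∨_)
open import Data.Bool.Properties using () renaming (_≟_ to _≟ᴮ_)
open import Data.Vec using ([]; _∷_; lookup)
open import Data.Vec.Properties using (≡-dec)
open import Data.List using (List; []; _∷_; map; foldr; _++_)
open import Data.Product using (_×_; _,_)
open import Relation.Nullary using (yes; no)
open import Relation.Nullary.Decidable using (dec-true; dec-false)
open import Relation.Binary.PropositionalEquality as ≡ using (_≡_)

==ˢ-sym : ∀ {n} (a b : Subset n) → (a ==ˢ b) ≡ (b ==ˢ a)
==ˢ-sym a b with ≡-dec _≟ᴮ_ a b
... | yes ≡.refl = ≡.sym (dec-true (≡-dec _≟ᴮ_ a a) ≡.refl)
... | no a≢b = ≡.sym (dec-false (≡-dec _≟ᴮ_ b a) (λ b≡a → a≢b (≡.sym b≡a)))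

module FiniteSums {c ℓ : Level} (K : CommutativeSemiring c ℓ) where
  open CommutativeSemiring K renaming (0# to 0̂)
  open import Algebra.Properties.CommutativeSemigroup +-commutativeSemigroup using (interchange)

  ⨁ : {A : Set} → List A → (A → Carrier) → Carrier
  ⨁ xs f = foldr (λ x r → f x + r) 0̂ xs

  [_]_ : Bool → Carrier → Carrier
  [ b ] x = if b then x else 0̂

  ⨁-cong : ∀ {A : Set} (xs : List A) {f g : A → Carrier} →
    (∀ x → f x ≈ g x) → ⨁ xs f ≈ ⨁ xs g
  ⨁-cong [] f≈g = refl
  ⨁-cong (x ∷ xs) f≈g = +-cong (f≈g x) (⨁-cong xs f≈g)

  ⨁-zero : ∀ {A : Set} (xs : List A) {f : A → Carrier} → (∀ x → f x ≈ 0̂) → ⨁ xs f ≈ 0̂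
  ⨁-zero [] f≈0 = refl
  ⨁-zero (x ∷ xs) f≈0 = trans (+-cong (f≈0 x) (⨁-zero xs f≈0)) (+-identityˡ 0̂)

  ⨁-distrib-+ : ∀ {A : Set} (xs : List A) (f g : A → Carrier) →
    ⨁ xs (λ x → f x + g x) ≈ ⨁ xs f + ⨁ xs g
  ⨁-distrib-+ [] f g = sym (+-identityˡ 0̂)
  ⨁-distrib-+ (x ∷ xs) f g = trans (+-congˡ (⨁-distrib-+ xs f g)) (interchange _ _ _ _)

  *-distribˡ-⨁ : ∀ {A : Set} (xs : List A) (f : A → Carrier) y →
    y * ⨁ xs f ≈ ⨁ xs (λ x → y * f x)
  *-distribˡ-⨁ [] f y = zeroʳ y
  *-distribˡ-⨁ (x ∷ xs) f y = trans (distribˡ y _ _) (+-congˡ (*-distribˡ-⨁ xs f y))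

  *-distribʳ-⨁ : ∀ {A : Set} (xs : List A) (f : A → Carrier) y →
    ⨁ xs f * y ≈ ⨁ xs (λ x → f x * y)
  *-distribʳ-⨁ [] f y = zeroˡ y
  *-distribʳ-⨁ (x ∷ xs) f y = trans (distribʳ y _ _) (+-congˡ (*-distribʳ-⨁ xs f y))

  ⨁-comm : ∀ {A B : Set} (xs : List A) (ys : List B) (f : A → B → Carrier) →
    ⨁ xs (λ x → ⨁ ys (f x)) ≈ ⨁ ys (λ y → ⨁ xs (λ x → f x y))
  ⨁-comm [] ys f = sym (⨁-zero ys (λ _ → refl))
  ⨁-comm (x ∷ xs) ys f = trans (+-congˡ (⨁-comm xs ys f)) (sym (⨁-distrib-+ ys (f x) _))

  ⨁-++ : ∀ {A : Set} (xs ys : List A) (f : A → Carrier) → ⨁ (xs ++ ys) f ≈ ⨁ xs f + ⨁ ys f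
  ⨁-++ [] ys f = sym (+-identityˡ _)
  ⨁-++ (x ∷ xs) ys f = trans (+-congˡ (⨁-++ xs ys f)) (sym (+-assoc _ _ _))

  ⨁-map : ∀ {A B : Set} (xs : List A) (g : A → B) (f : B → Carrier) →
    ⨁ (map g xs) f ≈ ⨁ xs (λ x → f (g x))
  ⨁-map [] g f = refl
  ⨁-map (x ∷ xs) g f = +-congˡ (⨁-map xs g f)

  []-cong : ∀ b {x y} → x ≈ y → [ b ] x ≈ [ b ] y
  []-cong true x≈y = x≈y
  []-cong false x≈y = refl

  []-cong₂ : ∀ {b b′ x y} → b ≡ b′ → x ≈ y → [ b ] x ≈ [ b′ ] y
  []-cong₂ {b} ≡.refl = []-cong b

  []-zero : ∀ b → [ b ] 0̂ ≈ 0̂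
  []-zero true = refl
  []-zero false = refl

  []-∧ : ∀ b b′ x → [ b ] ([ b′ ] x) ≡ [ b ∧ b′ ] x
  []-∧ true b′ x = ≡.refl
  []-∧ false b′ x = ≡.refl

  []-swap : ∀ b b′ x → [ b ] ([ b′ ] x) ≡ [ b′ ] ([ b ] x)
  []-swap true b′ x = ≡.refl
  []-swap false true x = ≡.refl
  []-swap false false x = ≡.refl

  []-distrib-+ : ∀ b x y → [ b ] (x + y) ≈ [ b ] x + [ b ] y
  []-distrib-+ true x y = refl
  []-distrib-+ false x y = sym (+-identityˡ 0̂)

  []-*ˡ : ∀ b x y → ([ b ] x) * y ≈ [ b ] (x * y)
  []-*ˡ true x y = refl
  []-*ˡ false x y = zeroˡ y

  []-*ʳ : ∀ b x y → x * ([ b ] y) ≈ [ b ] (x * y)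
  []-*ʳ true x y = refl
  []-*ʳ false x y = zeroʳ x

  []-⨁ : ∀ {A : Set} b (xs : List A) (f : A → Carrier) → [ b ] ⨁ xs f ≈ ⨁ xs (λ x → [ b ] f x)
  []-⨁ true xs f = refl
  []-⨁ false xs f = sym (⨁-zero xs (λ _ → refl))

  []-*ʳ-⨁ : ∀ {A : Set} b (xs : List A) (f : A → Carrier) y →
    [ b ] (⨁ xs f * y) ≈ ⨁ xs (λ x → [ b ] (f x * y))
  []-*ʳ-⨁ b xs f y = trans ([]-cong b (*-distribʳ-⨁ xs f y)) ([]-⨁ b xs _)

  ⨁-[]-idem : (∀ x → x + x ≈ x) → ∀ {A : Set} (xs : List A) (p : A → Bool) y →
    ⨁ xs (λ x → [ p x ] y) ≈ [ foldr (λ x r → p x ∨ r) false xs ] y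
  ⨁-[]-idem idem [] p y = refl
  ⨁-[]-idem idem (x ∷ xs) p y with p x
  ... | true = trans (+-congˡ (⨁-[]-idem idem xs p y)) (absorb _)
    where
    absorb : ∀ b → y + [ b ] y ≈ y
    absorb true = idem y
    absorb false = +-identityʳ y
  ... | false = trans (+-identityˡ _) (⨁-[]-idem idem xs p y)

module SubsetSums {c ℓ : Level} (K : CommutativeSemiring c ℓ) where
  open CommutativeSemiring K
  open import Relation.Binary.Reasoning.Setoid setoid
  open FiniteSums K

  ⨁-indicatorˡ : ∀ {n} (a : Subset n) (g : Subset n → Carrier) →
    ⨁ (allSubsets n) (λ b → [ b ==ˢ a ] g b) ≈ g a
  ⨁-indicatorˡ {zero} [] g = +-identityʳ _
  ⨁-indicatorˡ {suc n} (x ∷ a) g = begin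
      ⨁ (map (true ∷_) S ++ map (false ∷_) S) F
    ≈⟨ ⨁-++ (map (true ∷_) S) _ F ⟩
      ⨁ (map (true ∷_) S) F + ⨁ (map (false ∷_) S) F
    ≈⟨ +-cong (⨁-map S _ F) (⨁-map S _ F) ⟩
      ⨁ S (λ b → F (true ∷ b)) + ⨁ S (λ b → F (false ∷ b))
    ≈⟨ split x ⟩
      g (x ∷ a) ∎
    where
    S = allSubsets n
    F = λ b → [ b ==ˢ (x ∷ a) ] g b
    split : ∀ x → ⨁ S (λ b → [ (true ∷ b) ==ˢ (x ∷ a) ] g (true ∷ b))
                + ⨁ S (λ b → [ (false ∷ b) ==ˢ (x ∷ a) ] g (false ∷ b)) ≈ g (x ∷ a)
    split true = trans (+-cong (⨁-indicatorˡ a _) (⨁-zero S (λ _ → refl))) (+-identityʳ _)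
    split false = trans (+-cong (⨁-zero S (λ _ → refl)) (⨁-indicatorˡ a _)) (+-identityˡ _)

  ⨁-indicatorʳ : ∀ {n} (a : Subset n) (g : Subset n → Carrier) →
    ⨁ (allSubsets n) (λ b → [ a ==ˢ b ] g b) ≈ g a
  ⨁-indicatorʳ a g =
    trans (⨁-cong (allSubsets _) (λ b → []-cong₂ (==ˢ-sym a b) refl)) (⨁-indicatorˡ a g)

module UnionConvolution {c ℓ : Level} (K : CommutativeSemiring c ℓ) (n : ℕ) where
  open CommutativeSemiring K renaming (0# to 0̂; 1# to 1̂)
  open import Relation.Binary.Reasoning.Setoid setoid
  open FiniteSums K
  open SubsetSums K

  Weight : Set c
  Weight = Subset n → Carrier

  S : List (Subset n)
  S = allSubsets n

  infix 4 _≐_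
  _≐_ : Weight → Weight → Set ℓ
  f ≐ g = ∀ a → f a ≈ g a

  infixl 6 _⊞_
  _⊞_ : Weight → Weight → Weight
  (f ⊞ g) a = f a + g a

  infixl 7 _⋆_
  _⋆_ : Weight → Weight → Weight
  (f ⋆ g) a = ⨁ S (λ x → ⨁ S (λ y → [ (x ∪ y) ==ˢ a ] (f x * g y)))

  -- Oriented as ⊥ ==ˢ a so that ε is definitionally the weight of 𝟙.
  ε : Weight
  ε a = [ ⊥ ==ˢ a ] 1̂

  ⋆-cong : ∀ {f f′ g g′} → f ≐ f′ → g ≐ g′ → f ⋆ g ≐ f′ ⋆ g′
  ⋆-cong f≐f′ g≐g′ a = ⨁-cong S (λ x → ⨁-cong S (λ y → []-cong _ (*-cong (f≐f′ x) (g≐g′ y))))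

  ⋆-comm : ∀ f g → f ⋆ g ≐ g ⋆ f
  ⋆-comm f g a = trans (⨁-comm S S _) (⨁-cong S (λ y → ⨁-cong S (λ x →
    []-cong₂ (≡.cong (_==ˢ a) (∪-comm x y)) (*-comm (f x) (g y)))))

  ⋆-identityʳ : ∀ f → f ⋆ ε ≐ f
  ⋆-identityʳ f a = begin
      (f ⋆ ε) a
    ≈⟨ ⨁-cong S (λ x → ⨁-cong S (λ y →
         trans ([]-cong ((x ∪ y) ==ˢ a) ([]-*ʳ (⊥ ==ˢ y) (f x) 1̂))
               (reflexive ([]-swap ((x ∪ y) ==ˢ a) (⊥ ==ˢ y) (f x * 1̂))))) ⟩
      ⨁ S (λ x → ⨁ S (λ y → [ ⊥ ==ˢ y ] ([ (x ∪ y) ==ˢ a ] (f x * 1̂))))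
    ≈⟨ ⨁-cong S (λ x → ⨁-indicatorʳ ⊥ (λ y → [ (x ∪ y) ==ˢ a ] (f x * 1̂))) ⟩
      ⨁ S (λ x → [ (x ∪ ⊥) ==ˢ a ] (f x * 1̂))
    ≈⟨ ⨁-cong S (λ x → []-cong₂ (≡.cong (_==ˢ a) (∪-identityʳ x)) (*-identityʳ (f x))) ⟩
      ⨁ S (λ x → [ x ==ˢ a ] f x)
    ≈⟨ ⨁-indicatorˡ a f ⟩
      f a ∎

  ⋆-zeroʳ : ∀ f → f ⋆ (λ _ → 0̂) ≐ (λ _ → 0̂)
  ⋆-zeroʳ f a = ⨁-zero S (λ x → ⨁-zero S (λ y → trans ([]-cong _ (zeroʳ (f x))) ([]-zero _)))

  ⋆-distribˡ-⊞ : ∀ f g h → f ⋆ (g ⊞ h) ≐ f ⋆ g ⊞ f ⋆ h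
  ⋆-distribˡ-⊞ f g h a = trans
    (⨁-cong S (λ x → trans
      (⨁-cong S (λ y → trans ([]-cong _ (distribˡ (f x) (g y) (h y))) ([]-distrib-+ _ _ _)))
      (⨁-distrib-+ S _ _)))
    (⨁-distrib-+ S _ _)

  ⋆-distribʳ-⊞ : ∀ f g h → (f ⊞ g) ⋆ h ≐ f ⋆ h ⊞ g ⋆ h
  ⋆-distribʳ-⊞ f g h a = begin
      ((f ⊞ g) ⋆ h) a        ≈⟨ ⋆-comm (f ⊞ g) h a ⟩
      (h ⋆ (f ⊞ g)) a        ≈⟨ ⋆-distribˡ-⊞ h f g a ⟩
      (h ⋆ f) a + (h ⋆ g) a  ≈⟨ +-cong (⋆-comm h f a) (⋆-comm h g a) ⟩
      (f ⋆ h) a + (g ⋆ h) a  ∎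

  -- Both bracketings expand to ⋆₃, up to reversing the arguments and commuting ⋆.
  ⋆₃ : Weight → Weight → Weight → Weight
  ⋆₃ f g h a = ⨁ S (λ x → ⨁ S (λ y → ⨁ S (λ z → [ ((x ∪ y) ∪ z) ==ˢ a ] ((f x * g y) * h z))))

  ⋆⋆-expand : ∀ f g h → (f ⋆ g) ⋆ h ≐ ⋆₃ f g h
  ⋆⋆-expand f g h a = begin
      ((f ⋆ g) ⋆ h) a
    ≈⟨ ⨁-cong S (λ b → ⨁-cong S (λ z → expand b z)) ⟩
      ⨁ S (λ b → ⨁ S (λ z → ⨁ S (λ x → ⨁ S (λ y → G b z x y))))
    ≈⟨ ⨁-cong S (λ b → trans (⨁-comm S S _) (⨁-cong S (λ x → ⨁-comm S S _))) ⟩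
      ⨁ S (λ b → ⨁ S (λ x → ⨁ S (λ y → ⨁ S (λ z → G b z x y))))
    ≈⟨ trans (⨁-comm S S _) (⨁-cong S (λ x → trans (⨁-comm S S _)
                                        (⨁-cong S (λ y → ⨁-comm S S _)))) ⟩
      ⨁ S (λ x → ⨁ S (λ y → ⨁ S (λ z → ⨁ S (λ b → G b z x y))))
    ≈⟨ ⨁-cong S (λ x → ⨁-cong S (λ y → ⨁-cong S (λ z →
         ⨁-indicatorʳ (x ∪ y) (λ b → [ (b ∪ z) ==ˢ a ] ((f x * g y) * h z))))) ⟩
      ⋆₃ f g h a ∎
    where
    G : Subset n → Subset n → Subset n → Subset n → Carrier
    G b z x y = [ (x ∪ y) ==ˢ b ] ([ (b ∪ z) ==ˢ a ] ((f x * g y) * h z))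
    expand : ∀ b z → [ (b ∪ z) ==ˢ a ] ((f ⋆ g) b * h z) ≈ ⨁ S (λ x → ⨁ S (λ y → G b z x y))
    expand b z = trans ([]-*ʳ-⨁ _ S _ (h z)) (⨁-cong S (λ x →
      trans ([]-*ʳ-⨁ _ S _ (h z)) (⨁-cong S (λ y →
        trans ([]-cong q ([]-*ˡ ((x ∪ y) ==ˢ b) (f x * g y) (h z)))
              (reflexive ([]-swap q ((x ∪ y) ==ˢ b) ((f x * g y) * h z)))))))
      where q = (b ∪ z) ==ˢ a

  ⋆₃-reverse : ∀ f g h → ⋆₃ f g h ≐ ⋆₃ h g f
  ⋆₃-reverse f g h a =
    trans (⨁-comm S S _) (trans (⨁-cong S (λ y → ⨁-comm S S _)) (trans (⨁-comm S S _)
      (⨁-cong S (λ z → ⨁-cong S (λ y → ⨁-cong S (λ x →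
        []-cong₂ (≡.cong (_==ˢ a) (∪-reverse x y z)) (*-reverse (f x) (g y) (h z))))))))
    where
    ∪-reverse : ∀ x y z → (x ∪ y) ∪ z ≡ (z ∪ y) ∪ x
    ∪-reverse x y z = ≡.trans (∪-comm (x ∪ y) z)
      (≡.trans (≡.cong (z ∪_) (∪-comm x y)) (≡.sym (∪-assoc z y x)))
    *-reverse : ∀ u v w → (u * v) * w ≈ (w * v) * u
    *-reverse u v w = trans (*-comm (u * v) w) (trans (*-congˡ (*-comm u v)) (sym (*-assoc w v u)))

  ⋆-assoc : ∀ f g h → (f ⋆ g) ⋆ h ≐ f ⋆ (g ⋆ h)
  ⋆-assoc f g h a = begin
      ((f ⋆ g) ⋆ h) a  ≈⟨ ⋆⋆-expand f g h a ⟩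
      ⋆₃ f g h a        ≈⟨ ⋆₃-reverse f g h a ⟩
      ⋆₃ h g f a        ≈⟨ ⋆⋆-expand h g f a ⟨
      ((h ⋆ g) ⋆ f) a  ≈⟨ ⋆-comm (h ⋆ g) f a ⟩
      (f ⋆ (h ⋆ g)) a  ≈⟨ ⋆-cong (λ _ → refl) (⋆-comm h g) a ⟩
      (f ⋆ (g ⋆ h)) a  ∎

module Laws {c ℓ : Level} (K : CommutativeSemiring c ℓ) (idem : AddIdempotent K) {n : ℕ}
            (k : Fin n → CommutativeSemiring.Carrier K) where
  open CommutativeSemiring K renaming (1# to 1̂)
  open import Relation.Binary.Reasoning.Setoid setoid
  open FiniteSums K
  open SubsetSums K
  open UnionConvolution K n
  open Semantics K k hiding (⨁)

  weight : wAI n → Weight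
  weight z a = ‖ z ‖ ⟦ a ⟧ˢ

  ⨁∈-cong : ∀ γ {f g : Weight} → f ≐ g → ⨁∈ γ f ≈ ⨁∈ γ g
  ⨁∈-cong γ f≐g = ⨁-cong S (λ a → []-cong (γ a) (f≐g a))

  ⨁∈-singleton : ∀ a (f : Weight) → ⨁∈ ⟦ a ⟧ˢ f ≈ f a
  ⨁∈-singleton a f = ⨁-indicatorˡ a f

  weight-⊕ : ∀ z₁ z₂ → weight (z₁ ⊕ z₂) ≐ weight z₁ ⊞ weight z₂
  weight-⊕ z₁ z₂ a = ⨁∈-singleton a (weight z₁ ⊞ weight z₂)

  weight-⊗ : ∀ z₁ z₂ → weight (z₁ ⊗ z₂) ≐ weight z₁ ⋆ weight z₂
  weight-⊗ z₁ z₂ a = ⨁∈-singleton a (weight z₁ ⋆ weight z₂)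

  ⨁∈-port : ∀ γ p → ⨁∈ γ (λ a → [ lookup a p ] k p) ≈ ‖ port p ‖ γ
  ⨁∈-port γ p = trans (⨁-cong S (λ a → reflexive ([]-∧ (γ a) (lookup a p) (k p))))
                      (⨁-[]-idem idem S (λ a → γ a ∧ lookup a p) (k p))

  weight-port : ∀ p a → weight (port p) a ≈ [ lookup a p ] k p
  weight-port p a = trans (sym (⨁∈-port ⟦ a ⟧ˢ p)) (⨁∈-singleton a (λ b → [ lookup b p ] k p))

  decompose : ∀ z γ → ‖ z ‖ γ ≈ ⨁∈ γ (weight z)
  decompose 𝟘 γ = sym (⨁-zero S (λ a → []-zero (γ a)))
  decompose 𝟙 γ = sym (trans
    (⨁-cong S (λ a → reflexive ([]-swap (γ a) (⊥ ==ˢ a) 1̂)))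
    (⨁-indicatorʳ ⊥ (λ a → [ γ a ] 1̂)))
  decompose (port p) γ = sym (trans (⨁∈-cong γ (weight-port p)) (⨁∈-port γ p))
  decompose (z₁ ⊕ z₂) γ = sym (⨁∈-cong γ (weight-⊕ z₁ z₂))
  decompose (z₁ ⊗ z₂) γ = sym (⨁∈-cong γ (weight-⊗ z₁ z₂))
  decompose ⟨ z ⟩ γ = decompose z γ

  weight-≐⇒≡ʷ : ∀ z z′ → weight z ≐ weight z′ → z ≡ʷ z′
  weight-≐⇒≡ʷ z z′ w≐w′ γ =
    trans (decompose z γ) (trans (⨁∈-cong γ w≐w′) (sym (decompose z′ γ)))

  ⊕-assoc : ∀ z₁ z₂ z₃ → (z₁ ⊕ z₂) ⊕ z₃ ≡ʷ z₁ ⊕ (z₂ ⊕ z₃)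
  ⊕-assoc z₁ z₂ z₃ = weight-≐⇒≡ʷ ((z₁ ⊕ z₂) ⊕ z₃) (z₁ ⊕ (z₂ ⊕ z₃)) λ a → begin
    weight ((z₁ ⊕ z₂) ⊕ z₃) a                 ≈⟨ weight-⊕ (z₁ ⊕ z₂) z₃ a ⟩
    weight (z₁ ⊕ z₂) a + weight z₃ a          ≈⟨ +-congʳ (weight-⊕ z₁ z₂ a) ⟩
    (weight z₁ a + weight z₂ a) + weight z₃ a ≈⟨ +-assoc _ _ _ ⟩
    weight z₁ a + (weight z₂ a + weight z₃ a) ≈⟨ +-congˡ (weight-⊕ z₂ z₃ a) ⟨
    weight z₁ a + weight (z₂ ⊕ z₃) a          ≈⟨ weight-⊕ z₁ (z₂ ⊕ z₃) a ⟨
    weight (z₁ ⊕ (z₂ ⊕ z₃)) a                 ∎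

  ⊕-comm : ∀ z₁ z₂ → z₁ ⊕ z₂ ≡ʷ z₂ ⊕ z₁
  ⊕-comm z₁ z₂ = weight-≐⇒≡ʷ (z₁ ⊕ z₂) (z₂ ⊕ z₁) λ a →
    trans (weight-⊕ z₁ z₂ a) (trans (+-comm _ _) (sym (weight-⊕ z₂ z₁ a)))

  ⊕-idem : ∀ z → z ⊕ z ≡ʷ z
  ⊕-idem z = weight-≐⇒≡ʷ (z ⊕ z) z λ a → trans (weight-⊕ z z a) (idem (weight z a))

  ⊕-identityʳ : ∀ z → z ⊕ 𝟘 ≡ʷ z
  ⊕-identityʳ z = weight-≐⇒≡ʷ (z ⊕ 𝟘) z λ a → trans (weight-⊕ z 𝟘 a) (+-identityʳ (weight z a))

  ⊗-assoc : ∀ z₁ z₂ z₃ → (z₁ ⊗ z₂) ⊗ z₃ ≡ʷ z₁ ⊗ (z₂ ⊗ z₃)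
  ⊗-assoc z₁ z₂ z₃ = weight-≐⇒≡ʷ ((z₁ ⊗ z₂) ⊗ z₃) (z₁ ⊗ (z₂ ⊗ z₃)) λ a → begin
    weight ((z₁ ⊗ z₂) ⊗ z₃) a                  ≈⟨ weight-⊗ (z₁ ⊗ z₂) z₃ a ⟩
    (weight (z₁ ⊗ z₂) ⋆ weight z₃) a           ≈⟨ ⋆-cong (weight-⊗ z₁ z₂) (λ _ → refl) a ⟩
    ((weight z₁ ⋆ weight z₂) ⋆ weight z₃) a    ≈⟨ ⋆-assoc (weight z₁) (weight z₂) (weight z₃) a ⟩
    (weight z₁ ⋆ (weight z₂ ⋆ weight z₃)) a    ≈⟨ ⋆-cong (λ _ → refl) (weight-⊗ z₂ z₃) a ⟨
    (weight z₁ ⋆ weight (z₂ ⊗ z₃)) a           ≈⟨ weight-⊗ z₁ (z₂ ⊗ z₃) a ⟨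
    weight (z₁ ⊗ (z₂ ⊗ z₃)) a                  ∎

  ⊗-comm : ∀ z₁ z₂ → z₁ ⊗ z₂ ≡ʷ z₂ ⊗ z₁
  ⊗-comm z₁ z₂ = weight-≐⇒≡ʷ (z₁ ⊗ z₂) (z₂ ⊗ z₁) λ a →
    trans (weight-⊗ z₁ z₂ a) (trans (⋆-comm (weight z₁) (weight z₂) a) (sym (weight-⊗ z₂ z₁ a)))

  ⊗-identityʳ : ∀ z → z ⊗ 𝟙 ≡ʷ z
  ⊗-identityʳ z = weight-≐⇒≡ʷ (z ⊗ 𝟙) z λ a → trans (weight-⊗ z 𝟙 a) (⋆-identityʳ (weight z) a)

  ⊗-zeroʳ : ∀ z → z ⊗ 𝟘 ≡ʷ 𝟘
  ⊗-zeroʳ z = weight-≐⇒≡ʷ (z ⊗ 𝟘) 𝟘 λ a → trans (weight-⊗ z 𝟘 a) (⋆-zeroʳ (weight z) a)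

  ⊗-distribˡ-⊕ : ∀ z₁ z₂ z₃ → z₁ ⊗ (z₂ ⊕ z₃) ≡ʷ (z₁ ⊗ z₂) ⊕ (z₁ ⊗ z₃)
  ⊗-distribˡ-⊕ z₁ z₂ z₃ = weight-≐⇒≡ʷ (z₁ ⊗ (z₂ ⊕ z₃)) ((z₁ ⊗ z₂) ⊕ (z₁ ⊗ z₃)) λ a → begin
    weight (z₁ ⊗ (z₂ ⊕ z₃)) a                  ≈⟨ weight-⊗ z₁ (z₂ ⊕ z₃) a ⟩
    (weight z₁ ⋆ weight (z₂ ⊕ z₃)) a           ≈⟨ ⋆-cong (λ _ → refl) (weight-⊕ z₂ z₃) a ⟩
    (weight z₁ ⋆ (weight z₂ ⊞ weight z₃)) a    ≈⟨ ⋆-distribˡ-⊞ (weight z₁) (weight z₂) (weight z₃) a ⟩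
    (weight z₁ ⋆ weight z₂ ⊞ weight z₁ ⋆ weight z₃) a
      ≈⟨ +-cong (weight-⊗ z₁ z₂ a) (weight-⊗ z₁ z₃ a) ⟨
    weight (z₁ ⊗ z₂) a + weight (z₁ ⊗ z₃) a    ≈⟨ weight-⊕ (z₁ ⊗ z₂) (z₁ ⊗ z₃) a ⟨
    weight ((z₁ ⊗ z₂) ⊕ (z₁ ⊗ z₃)) a           ∎

  ⊗-distribʳ-⊕ : ∀ z₁ z₂ z₃ → (z₁ ⊕ z₂) ⊗ z₃ ≡ʷ (z₁ ⊗ z₃) ⊕ (z₂ ⊗ z₃)
  ⊗-distribʳ-⊕ z₁ z₂ z₃ = weight-≐⇒≡ʷ ((z₁ ⊕ z₂) ⊗ z₃) ((z₁ ⊗ z₃) ⊕ (z₂ ⊗ z₃)) λ a → begin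
    weight ((z₁ ⊕ z₂) ⊗ z₃) a                  ≈⟨ weight-⊗ (z₁ ⊕ z₂) z₃ a ⟩
    (weight (z₁ ⊕ z₂) ⋆ weight z₃) a           ≈⟨ ⋆-cong (weight-⊕ z₁ z₂) (λ _ → refl) a ⟩
    ((weight z₁ ⊞ weight z₂) ⋆ weight z₃) a    ≈⟨ ⋆-distribʳ-⊞ (weight z₁) (weight z₂) (weight z₃) a ⟩
    (weight z₁ ⋆ weight z₃ ⊞ weight z₂ ⋆ weight z₃) a
      ≈⟨ +-cong (weight-⊗ z₁ z₃ a) (weight-⊗ z₂ z₃ a) ⟨
    weight (z₁ ⊗ z₃) a + weight (z₂ ⊗ z₃) a    ≈⟨ weight-⊕ (z₁ ⊗ z₃) (z₂ ⊗ z₃) a ⟨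
    weight ((z₁ ⊗ z₃) ⊕ (z₂ ⊗ z₃)) a           ∎

proposition1 : {c ℓ : Level} (K : CommutativeSemiring c ℓ) → AddIdempotent K →
  (m : ℕ) (k : Fin (suc m) → CommutativeSemiring.Carrier K) →
  let open Semantics K k in
  (z₁ z₂ z₃ : wAI (suc m)) →
    ((z₁ ⊕ z₂) ⊕ z₃ ≡ʷ z₁ ⊕ (z₂ ⊕ z₃))
    × (z₁ ⊕ z₂ ≡ʷ z₂ ⊕ z₁)
    × (z₁ ⊕ z₁ ≡ʷ z₁)
    × (z₁ ⊕ 𝟘 ≡ʷ z₁)
    × ((z₁ ⊗ z₂) ⊗ z₃ ≡ʷ z₁ ⊗ (z₂ ⊗ z₃))
    × (z₁ ⊗ z₂ ≡ʷ z₂ ⊗ z₁)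
    × (z₁ ⊗ 𝟙 ≡ʷ z₁)
    × (z₁ ⊗ 𝟘 ≡ʷ 𝟘)
    × (z₁ ⊗ (z₂ ⊕ z₃) ≡ʷ (z₁ ⊗ z₂) ⊕ (z₁ ⊗ z₃))
    × ((z₁ ⊕ z₂) ⊗ z₃ ≡ʷ (z₁ ⊗ z₃) ⊕ (z₂ ⊗ z₃))
proposition1 K idem m k z₁ z₂ z₃ =
  ⊕-assoc z₁ z₂ z₃ , ⊕-comm z₁ z₂ , ⊕-idem z₁ , ⊕-identityʳ z₁ ,
  ⊗-assoc z₁ z₂ z₃ , ⊗-comm z₁ z₂ , ⊗-identityʳ z₁ , ⊗-zeroʳ z₁ ,
  ⊗-distribˡ-⊕ z₁ z₂ z₃ , ⊗-distribʳ-⊕ z₁ z₂ z₃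
  where open Laws K idem k
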